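{- Let $\varepsilon>0$. Let a finite group $H$ act transitively on a finite set $W$. Assume a non-empty subset $C\subseteq W$ satisfies $|C\triangle h\cdot C|\leq\varepsilon|C|$ for every $h\in H$. Then $|W\setminus C|\leq\frac{\varepsilon}{2}|W|$. In particular, if $|C|\leq |W|/2$, then $\varepsilon\geq 1$.
   Formalization: The parameter ε ranges over the positive rationals. -}

module Defs where

open import Level using (Level)
open import Data.Nat using (ℕ)
open import Data.Fin using (Fin; _≟_)
open import Data.Fin.Subset using (Subset; _∪_; _─_; _∈_)
open import Data.Fin.Subset.Properties using (_∈?_)
open import Data.Fin.Properties using (any?)
open import Data.Vec using (tabulate)
open import Data.Bool using (Bool)
open import Data.Product using (Σ; ∃)
open import Data.Integer using (+_)
open import Data.Rational using (ℚ; _/_)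
open import Relation.Nullary using (does)
open import Relation.Nullary.Decidable using (_×-dec_)
open import Relation.Binary.PropositionalEquality using (_≡_)
open import Algebra.Bundles using (Group)

ℕ→ℚ : ℕ → ℚ
ℕ→ℚ k = + k / 1

_△_ : ∀ {n} → Subset n → Subset n → Subset n
A △ B = (A ─ B) ∪ (B ─ A)

image : ∀ {n} → (Fin n → Fin n) → Subset n → Subset n
image f C = tabulate λ y → does (any? λ x → (x ∈? C) ×-dec (f x ≟ y))

module _ {c ℓ : Level} (H : Group c ℓ) where
  open Group H

  FiniteGroup : Set (c Level.⊔ ℓ)
  FiniteGroup = Σ ℕ λ m → Σ (Fin m → Carrier) λ enum → ∀ (h : Carrier) → ∃ λ i → enum i ≈ h

  record IsAction {n : ℕ} (act : Carrier → Fin n → Fin n) : Set (c Level.⊔ ℓ) where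
    field
      act-cong : ∀ {g h} → g ≈ h → ∀ x → act g x ≡ act h x
      act-id   : ∀ x → act ε x ≡ x
      act-∙    : ∀ g h x → act (g ∙ h) x ≡ act g (act h x)

  Transitive : {n : ℕ} → (Carrier → Fin n → Fin n) → Set c
  Transitive {n} act = ∀ (x y : Fin n) → ∃ λ h → act h x ≡ y

{-# OPTIONS --safe #-}
-- The action factors through the image of H in the symmetric group of W, and this finite group
-- still acts transitively, so for each y ∈ W its elements send y to every point of W equally
-- often. Averaging ∣C ∩ g⁻¹C∣ over the image therefore gives ∣C∣²/∣W∣, so some g has
-- ∣C ∩ g⁻¹C∣ ≤ ∣C∣²/∣W∣, and then ∣C △ g⁻¹C∣ = 2∣C∣ − 2∣C ∩ g⁻¹C∣ ≥ 2∣C∣∣W ∖ C∣/∣W∣.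
-- Together with ∣C △ g⁻¹C∣ ≤ ε∣C∣ this is 2∣W ∖ C∣ ≤ ε∣W∣; if moreover ∣C∣ ≤ ∣W∣/2,
-- then ∣W∣ ≤ 2∣W ∖ C∣ and hence ε ≥ 1.
module Submission where

open import Defs
open import Level using (Level)
open import Data.Fin using (Fin)
open import Data.Fin.Subset using (Subset; ∣_∣; ∁; Nonempty)
open import Data.Product using (_×_)
open import Algebra.Bundles using (Group)

module Counting where

  open import Data.Bool using (Bool; true; false; _xor_)
  open import Data.Nat using (ℕ; zero; suc; _+_; _*_; _≤_; _<_; z≤n)
  open import Data.Nat.Properties
    using (_≤?_; ≤-reflexive; ≤-trans; ≤-antisym; <⇒≱; ≰⇒>; ≮⇒≥; m≤m+n; m≤n+m; m<n+m;
           +-identityʳ; *-identityʳ; *-assoc; *-suc; m+[n∸m]≡n; +-mono-≤; +-monoʳ-≤; +-cancelʳ-≤;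
           *-monoʳ-≤; +-*-semiring; *-commutativeSemigroup; module ≤-Reasoning)
  open import Data.Nat.Solver using (module +-*-Solver)
  open +-*-Solver using (solve; _:+_; _:*_; _:=_; con)
  open import Algebra.Properties.CommutativeSemigroup *-commutativeSemigroup using (x∙yz≈y∙xz)
  open import Algebra.Properties.Semiring.Sum +-*-semiring
    using (sum-syntax; sum-cong-≗; sum-replicate-zero; sum-permute;
           ∑-comm; ∑-distrib-+; *-distribˡ-sum; *-distribʳ-sum)
  open import Data.Fin using (zero; suc; _≟_; toℕ; fromℕ<)
  open import Data.Fin.Properties
    using (any?; all?; toℕ-injective; toℕ-inject; toℕ-fromℕ<; ¬∀⟶∃¬-smallest)
  open import Data.Fin.Permutation using (permutation)
  open import Data.Fin.Subset using (_∈_)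
  open import Data.Fin.Subset.Properties using (_∈?_; ∣∁p∣≡n∸∣p∣; ∣p∣≤n)
  open import Data.Vec using ([]; _∷_; lookup)
  open import Data.Vec.Properties using (lookup∘tabulate; []=⇒lookup)
  open import Data.Product using (∃; _,_; proj₁; proj₂)
  open import Function using (_∘_; mk⇔)
  open import Relation.Nullary using (Dec; does; yes; no; ¬_; contradiction)
  open import Relation.Nullary.Decidable
    using (_×-dec_; _→-dec_; ¬?; dec-true; dec-false; does-⇔; decidable-stable)
  open import Relation.Unary using (Pred; Decidable)
  open import Relation.Binary.PropositionalEquality
    using (_≡_; _≗_; refl; sym; trans; cong; cong₂; subst; module ≡-Reasoning)

  [_] : Bool → ℕ
  [ true  ] = 1
  [ false ] = 0

  ∑-const : ∀ n c → ∑[ i < n ] c ≡ n * c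
  ∑-const zero    c = refl
  ∑-const (suc n) c = cong (c +_) (∑-const n c)

  term≤∑ : ∀ {n} (f : Fin n → ℕ) i → f i ≤ ∑[ j < n ] f j
  term≤∑ f zero    = m≤m+n _ _
  term≤∑ f (suc i) = ≤-trans (term≤∑ (f ∘ suc) i) (m≤n+m _ _)

  ∑-mono-≤ : ∀ {n} {f g : Fin n → ℕ} → (∀ i → f i ≤ g i) → ∑[ i < n ] f i ≤ ∑[ i < n ] g i
  ∑-mono-≤ {zero}  f≤g = z≤n
  ∑-mono-≤ {suc n} f≤g = +-mono-≤ (f≤g zero) (∑-mono-≤ (f≤g ∘ suc))

  ∑-δ : ∀ {n} (a : Fin n) (f : Fin n → ℕ) → ∑[ z < n ] ([ does (a ≟ z) ] * f z) ≡ f a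
  ∑-δ {suc n} zero    f =
    trans (cong₂ _+_ (+-identityʳ (f zero)) (sum-replicate-zero n)) (+-identityʳ (f zero))
  ∑-δ {suc n} (suc a) f = ∑-δ a (f ∘ suc)

  ∑-∘-bijection : ∀ {n} (f : Fin n → ℕ) {π π⁻¹ : Fin n → Fin n} →
                  (∀ x → π⁻¹ (π x) ≡ x) → (∀ y → π (π⁻¹ y) ≡ y) →
                  ∑[ y < n ] f (π y) ≡ ∑[ y < n ] f y
  ∑-∘-bijection f π⁻¹π ππ⁻¹ = sym (sum-permute f (permutation _ _ ππ⁻¹ π⁻¹π))

  module _ {m p} {P : Pred (Fin m) p} (P? : Decidable P) where

    private
      -- A permutation of Fin m whenever φ permutes P.
      extend : (Fin m → Fin m) → Fin m → Fin m
      extend φ i with P? i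
      ... | yes _ = φ i
      ... | no  _ = i

      extend-∈ : ∀ φ {i} → P i → extend φ i ≡ φ i
      extend-∈ φ {i} pi with P? i
      ... | yes _  = refl
      ... | no ¬pi = contradiction pi ¬pi

      extend-∉ : ∀ φ {i} → ¬ P i → extend φ i ≡ i
      extend-∉ φ {i} ¬pi with P? i
      ... | yes pi = contradiction pi ¬pi
      ... | no  _  = refl

      extend-inverse : ∀ {φ ψ} → (∀ {i} → P i → P (φ i)) → (∀ {i} → P i → ψ (φ i) ≡ i) →
                       ∀ i → extend ψ (extend φ i) ≡ i
      extend-inverse {φ} {ψ} φ-closed ψφ i with P? i
      ... | yes pi = trans (extend-∈ ψ (φ-closed pi)) (ψφ pi)
      ... | no ¬pi = extend-∉ ψ ¬pi

    ∑-∘-bijectionOn : ∀ (φ ψ : Fin m → Fin m) →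
                      (∀ {i} → P i → P (φ i)) → (∀ {i} → P i → P (ψ i)) →
                      (∀ {i} → P i → ψ (φ i) ≡ i) → (∀ {i} → P i → φ (ψ i) ≡ i) →
                      (f : Fin m → ℕ) →
                      ∑[ i < m ] ([ does (P? i) ] * f (φ i)) ≡ ∑[ i < m ] ([ does (P? i) ] * f i)
    ∑-∘-bijectionOn φ ψ φ-closed ψ-closed ψφ φψ f = begin
      ∑[ i < m ] ([ does (P? i) ] * f (φ i))
        ≡⟨ sum-cong-≗ on-extension ⟨
      ∑[ i < m ] ([ does (P? (extend φ i)) ] * f (extend φ i))
        ≡⟨ ∑-∘-bijection (λ i → [ does (P? i) ] * f i)
                         (extend-inverse φ-closed ψφ) (extend-inverse ψ-closed φψ) ⟩
      ∑[ i < m ] ([ does (P? i) ] * f i) ∎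
      where
      open ≡-Reasoning
      on-extension : ∀ i → [ does (P? (extend φ i)) ] * f (extend φ i) ≡ [ does (P? i) ] * f (φ i)
      on-extension i with P? i
      ... | yes pi rewrite dec-true (P? (φ i)) (φ-closed pi) = refl
      ... | no ¬pi rewrite dec-false (P? i) ¬pi = refl

    ∃-below-mean : ∀ (a : Fin m → ℕ) {b} → ∃ P →
                   ∑[ i < m ] ([ does (P? i) ] * a i) ≤ (∑[ i < m ] [ does (P? i) ]) * b →
                   ∃ λ i → P i × a i ≤ b
    ∃-below-mean a {b} (j , pj) mean≤b with any? (λ i → P? i ×-dec a i ≤? b)
    ... | yes found = found
    ... | no  none  = contradiction mean≤b (<⇒≱ (begin-strict
      size * b                             <⟨ m<n+m (size * b) size>0 ⟩
      size + size * b                      ≡⟨ *-suc size b ⟨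
      size * suc b                         ≡⟨ *-distribʳ-sum (suc b) (λ i → [ does (P? i) ]) ⟩
      ∑[ i < m ] ([ does (P? i) ] * suc b) ≤⟨ ∑-mono-≤ exceeds ⟩
      ∑[ i < m ] ([ does (P? i) ] * a i)   ∎))
      where
      open ≤-Reasoning
      size : ℕ
      size = ∑[ i < m ] [ does (P? i) ]
      size>0 : 0 < size
      size>0 = ≤-trans (≤-reflexive (cong [_] (sym (dec-true (P? j) pj)))) (term≤∑ _ j)
      exceeds : ∀ i → [ does (P? i) ] * suc b ≤ [ does (P? i) ] * a i
      exceeds i with P? i
      ... | yes pi = *-monoʳ-≤ 1 (≰⇒> λ ai≤b → none (i , pi , ai≤b))
      ... | no  _  = z≤n

  ∣p∣≡∑ : ∀ {n} (p : Subset n) → ∣ p ∣ ≡ ∑[ i < n ] [ lookup p i ]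
  ∣p∣≡∑ []          = refl
  ∣p∣≡∑ (true  ∷ p) = cong suc (∣p∣≡∑ p)
  ∣p∣≡∑ (false ∷ p) = ∣p∣≡∑ p

  ∣p∣+∣∁p∣≡n : ∀ {n} (p : Subset n) → ∣ p ∣ + ∣ ∁ p ∣ ≡ n
  ∣p∣+∣∁p∣≡n p = trans (cong (∣ p ∣ +_) (∣∁p∣≡n∸∣p∣ p)) (m+[n∸m]≡n (∣p∣≤n p))

  nonempty⇒∣p∣>0 : ∀ {n} {p : Subset n} → Nonempty p → 0 < ∣ p ∣
  nonempty⇒∣p∣>0 {p = p} (x , x∈p) = subst (0 <_) (sym (∣p∣≡∑ p))
    (≤-trans (≤-reflexive (cong [_] (sym ([]=⇒lookup x∈p)))) (term≤∑ _ x))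

  does-∈? : ∀ {n} (x : Fin n) (p : Subset n) → does (x ∈? p) ≡ lookup p x
  does-∈? zero    (true  ∷ p) = refl
  does-∈? zero    (false ∷ p) = refl
  does-∈? (suc x) (_     ∷ p) = does-∈? x p

  lookup-△ : ∀ {n} (p q : Subset n) i → lookup (p △ q) i ≡ lookup p i xor lookup q i
  lookup-△ (true  ∷ p) (true  ∷ q) zero    = refl
  lookup-△ (true  ∷ p) (false ∷ q) zero    = refl
  lookup-△ (false ∷ p) (true  ∷ q) zero    = refl
  lookup-△ (false ∷ p) (false ∷ q) zero    = refl
  lookup-△ (_     ∷ p) (_     ∷ q) (suc i) = lookup-△ p q i

  lookup-image : ∀ {n} {f g : Fin n → Fin n} → (∀ x → g (f x) ≡ x) → (∀ y → f (g y) ≡ y) →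
                 ∀ p y → lookup (image f p) y ≡ lookup p (g y)
  lookup-image {f = f} {g} gf fg p y = begin
    lookup (image f p) y    ≡⟨ lookup∘tabulate _ y ⟩
    does ∃-preimage?        ≡⟨ does-⇔ (mk⇔ to from) ∃-preimage? (g y ∈? p) ⟩
    does (g y ∈? p)         ≡⟨ does-∈? (g y) p ⟩
    lookup p (g y)          ∎
    where
    open ≡-Reasoning
    ∃-preimage? : Dec (∃ λ x → x ∈ p × f x ≡ y)
    ∃-preimage? = any? λ x → (x ∈? p) ×-dec (f x ≟ y)
    to : (∃ λ x → x ∈ p × f x ≡ y) → g y ∈ p
    to (x , x∈p , fx≡y) = subst (_∈ p) (trans (sym (gf x)) (cong g fx≡y)) x∈p
    from : g y ∈ p → ∃ λ x → x ∈ p × f x ≡ y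
    from gy∈p = g y , gy∈p , fg y

  [a-xor-b]+2[a][b]≡[a]+[b] : ∀ a b → [ a xor b ] + 2 * ([ a ] * [ b ]) ≡ [ a ] + [ b ]
  [a-xor-b]+2[a][b]≡[a]+[b] true  true  = refl
  [a-xor-b]+2[a][b]≡[a]+[b] true  false = refl
  [a-xor-b]+2[a][b]≡[a]+[b] false true  = refl
  [a-xor-b]+2[a][b]≡[a]+[b] false false = refl

  kept : ∀ {n} → Subset n → (Fin n → Fin n) → ℕ
  kept {n} C σ = ∑[ y < n ] ([ lookup C y ] * [ lookup C (σ y) ])

  ∣C△fC∣+2kept≡2∣C∣ : ∀ {n} (f g : Fin n → Fin n) → (∀ x → g (f x) ≡ x) → (∀ y → f (g y) ≡ y) →
                      ∀ C → ∣ C △ image f C ∣ + 2 * kept C g ≡ ∣ C ∣ + ∣ C ∣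
  ∣C△fC∣+2kept≡2∣C∣ {n} f g gf fg C = begin
    ∣ C △ image f C ∣ + 2 * kept C g
      ≡⟨ cong₂ _+_ ∣C△fC∣≡∑ (*-distribˡ-sum 2 λ y → [ χ y ] * [ χ (g y) ]) ⟩
    ∑[ y < n ] [ χ y xor χ (g y) ] + ∑[ y < n ] (2 * ([ χ y ] * [ χ (g y) ]))
      ≡⟨ ∑-distrib-+ (λ y → [ χ y xor χ (g y) ]) (λ y → 2 * ([ χ y ] * [ χ (g y) ])) ⟨
    ∑[ y < n ] ([ χ y xor χ (g y) ] + 2 * ([ χ y ] * [ χ (g y) ]))
      ≡⟨ sum-cong-≗ (λ y → [a-xor-b]+2[a][b]≡[a]+[b] (χ y) (χ (g y))) ⟩
    ∑[ y < n ] ([ χ y ] + [ χ (g y) ])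
      ≡⟨ ∑-distrib-+ (λ y → [ χ y ]) (λ y → [ χ (g y) ]) ⟩
    ∑[ y < n ] [ χ y ] + ∑[ y < n ] [ χ (g y) ]
      ≡⟨ cong₂ _+_ (∣p∣≡∑ C) (trans (∣p∣≡∑ C) (sym (∑-∘-bijection (λ y → [ χ y ]) fg gf))) ⟨
    ∣ C ∣ + ∣ C ∣ ∎
    where
    open ≡-Reasoning
    χ : Fin n → Bool
    χ = lookup C
    ∣C△fC∣≡∑ : ∣ C △ image f C ∣ ≡ ∑[ y < n ] [ χ y xor χ (g y) ]
    ∣C△fC∣≡∑ = trans (∣p∣≡∑ (C △ image f C)) (sum-cong-≗ λ y →
      cong [_] (trans (lookup-△ C _ y) (cong (χ y xor_) (lookup-image gf fg C y))))

  t+2k≡2c⇒2cd≤tn : ∀ {n} c d t k → c + d ≡ n → t + 2 * k ≡ c + c → n * k ≤ c * c →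
                   2 * c * d ≤ t * n
  t+2k≡2c⇒2cd≤tn c d t k refl t+2k≡2c [c+d]k≤c² =
    +-cancelʳ-≤ (2 * (c * c)) (2 * c * d) (t * (c + d)) (begin
      2 * c * d + 2 * (c * c)
        ≡⟨ solve 2 (λ c d → con 2 :* c :* d :+ con 2 :* (c :* c) := (c :+ c) :* (c :+ d)) refl c d ⟩
      (c + c) * (c + d)
        ≡⟨ cong (_* (c + d)) t+2k≡2c ⟨
      (t + 2 * k) * (c + d)
        ≡⟨ solve 3 (λ t k n → (t :+ con 2 :* k) :* n := t :* n :+ con 2 :* (n :* k)) refl t k (c + d) ⟩
      t * (c + d) + 2 * ((c + d) * k)
        ≤⟨ +-monoʳ-≤ (t * (c + d)) (*-monoʳ-≤ 2 [c+d]k≤c²) ⟩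
      t * (c + d) + 2 * (c * c) ∎)
    where open ≤-Reasoning

  module _ {c ℓ} (H : Group c ℓ) {n} {act : Group.Carrier H → Fin n → Fin n}
           (isAction : IsAction H act) where

    open Group H using (Carrier; _≈_; _∙_; _⁻¹; ε; inverseˡ; inverseʳ)
    open IsAction isAction

    act-inverseˡ : ∀ g x → act (g ⁻¹) (act g x) ≡ x
    act-inverseˡ g x = trans (sym (act-∙ (g ⁻¹) g x)) (trans (act-cong (inverseˡ g) x) (act-id x))

    act-inverseʳ : ∀ g x → act g (act (g ⁻¹) x) ≡ x
    act-inverseʳ g x = trans (sym (act-∙ g (g ⁻¹) x)) (trans (act-cong (inverseʳ g) x) (act-id x))

    act-injective : ∀ g {x y} → act g x ≡ act g y → x ≡ y
    act-injective g {x} {y} eq =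
      trans (sym (act-inverseˡ g x)) (trans (cong (act (g ⁻¹)) eq) (act-inverseˡ g y))

    module _ {m} (enum : Fin m → Carrier) (enum-onto : ∀ g → ∃ λ i → enum i ≈ g) where

      index : Carrier → Fin m
      index g = proj₁ (enum-onto g)

      σ : Fin m → Fin n → Fin n
      σ i = act (enum i)

      _∼_ : Fin m → Fin m → Set
      i ∼ j = σ i ≗ σ j

      _∼?_ : ∀ i j → Dec (i ∼ j)
      i ∼? j = all? λ x → σ i x ≟ σ j x

      -- The enumeration may repeat elements up to ≈, and distinct elements may act alike;
      -- the least index of each action map stands for one element of the image of H in Sym(W).
      Canonical : Fin m → Set
      Canonical i = ∀ j → j ∼ i → toℕ i ≤ toℕ j

      canonical? : Decidable Canonical
      canonical? i = all? λ j → (j ∼? i) →-dec (toℕ i ≤? toℕ j)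

      canonical-unique : ∀ {i j} → Canonical i → Canonical j → i ∼ j → i ≡ j
      canonical-unique {i} {j} ci cj i∼j = toℕ-injective (≤-antisym (ci j (sym ∘ i∼j)) (cj i i∼j))

      canonical-exists : ∀ i → ∃ λ j → Canonical j × j ∼ i
      canonical-exists i
        with ¬∀⟶∃¬-smallest m (λ j → ¬ j ∼ i) (λ j → ¬? (j ∼? i)) (λ ∀≁ → ∀≁ i λ _ → refl)
      ... | j , ¬≁ , below = j , least , j∼i
        where
        j∼i : j ∼ i
        j∼i = decidable-stable (j ∼? i) ¬≁
        least : Canonical j
        least k k∼j = ≮⇒≥ λ k<j → below (fromℕ< k<j)
          (subst (_∼ i) (sym (toℕ-injective (trans (toℕ-inject (fromℕ< k<j)) (toℕ-fromℕ< k<j))))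
                 (λ x → trans (k∼j x) (j∼i x)))

      translate : Carrier → Fin m → Fin m
      translate g i = proj₁ (canonical-exists (index (g ∙ enum i)))

      translate-canonical : ∀ g i → Canonical (translate g i)
      translate-canonical g i = proj₁ (proj₂ (canonical-exists (index (g ∙ enum i))))

      σ-translate : ∀ g i → σ (translate g i) ≗ act g ∘ σ i
      σ-translate g i x = begin
        σ (translate g i) x       ≡⟨ proj₂ (proj₂ (canonical-exists (index (g ∙ enum i)))) x ⟩
        σ (index (g ∙ enum i)) x  ≡⟨ act-cong (proj₂ (enum-onto (g ∙ enum i))) x ⟩
        act (g ∙ enum i) x        ≡⟨ act-∙ g (enum i) x ⟩
        act g (σ i x)             ∎
        where open ≡-Reasoning

      translate-cancel : ∀ {g h} → (∀ x → act h (act g x) ≡ x) →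
                         ∀ {i} → Canonical i → translate h (translate g i) ≡ i
      translate-cancel {g} {h} hg {i} ci = canonical-unique (translate-canonical h _) ci λ x →
        trans (σ-translate h _ x) (trans (cong (act h) (σ-translate g i x)) (hg (σ i x)))

      weight : Fin m → ℕ
      weight i = [ does (canonical? i) ]

      order : ℕ
      order = ∑[ i < m ] weight i

      hits : Fin n → Fin n → ℕ
      hits y z = ∑[ i < m ] (weight i * [ does (σ i y ≟ z) ])

      hits-translate : ∀ g y z → hits y z ≡ hits y (act g z)
      hits-translate g y z = begin
        ∑[ i < m ] (weight i * [ does (σ i y ≟ z) ])
          ≡⟨ sum-cong-≗ (λ i → cong (weight i *_) (moved i)) ⟨
        ∑[ i < m ] (weight i * [ does (σ (translate g i) y ≟ act g z) ])
          ≡⟨ ∑-∘-bijectionOn canonical? (translate g) (translate (g ⁻¹))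
               (λ {i} _ → translate-canonical g i) (λ {i} _ → translate-canonical (g ⁻¹) i)
               (translate-cancel (act-inverseˡ g)) (translate-cancel (act-inverseʳ g))
               (λ i → [ does (σ i y ≟ act g z) ]) ⟩
        ∑[ i < m ] (weight i * [ does (σ i y ≟ act g z) ]) ∎
        where
        open ≡-Reasoning
        moved : ∀ i → [ does (σ (translate g i) y ≟ act g z) ] ≡ [ does (σ i y ≟ z) ]
        moved i = cong [_] (does-⇔
          (mk⇔ (λ eq → act-injective g (trans (sym (σ-translate g i y)) eq))
               (λ eq → trans (σ-translate g i y) (cong (act g) eq)))
          (σ (translate g i) y ≟ act g z) (σ i y ≟ z))

      module _ (transitive : Transitive H act) where

        n*hits≡order : ∀ y z → n * hits y z ≡ order
        n*hits≡order y z = begin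
          n * hits y z
            ≡⟨ ∑-const n (hits y z) ⟨
          ∑[ z′ < n ] hits y z
            ≡⟨ sum-cong-≗ hits-at ⟩
          ∑[ z′ < n ] ∑[ i < m ] (weight i * δ i z′)
            ≡⟨ ∑-comm (λ i z′ → weight i * δ i z′) ⟨
          ∑[ i < m ] ∑[ z′ < n ] (weight i * δ i z′)
            ≡⟨ sum-cong-≗ (λ i → *-distribˡ-sum (weight i) (δ i)) ⟨
          ∑[ i < m ] (weight i * ∑[ z′ < n ] δ i z′)
            ≡⟨ sum-cong-≗ (λ i → cong (weight i *_) (hit-once i)) ⟩
          ∑[ i < m ] (weight i * 1)
            ≡⟨ sum-cong-≗ (λ i → *-identityʳ (weight i)) ⟩
          order ∎
          where
          open ≡-Reasoning
          δ : Fin m → Fin n → ℕ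
          δ i z′ = [ does (σ i y ≟ z′) ]
          hits-at : ∀ z′ → hits y z ≡ hits y z′
          hits-at z′ = let g , gz≡z′ = transitive z z′ in
            trans (hits-translate g y z) (cong (hits y) gz≡z′)
          hit-once : ∀ i → ∑[ z′ < n ] δ i z′ ≡ 1
          hit-once i = trans (sum-cong-≗ {n} λ z′ → sym (*-identityʳ (δ i z′))) (∑-δ (σ i y) λ _ → 1)

        orbit-average : ∀ y (f : Fin n → ℕ) →
                        n * ∑[ i < m ] (weight i * f (σ i y)) ≡ order * ∑[ z < n ] f z
        orbit-average y f = begin
          n * ∑[ i < m ] (weight i * f (σ i y))
            ≡⟨ cong (n *_) (sum-cong-≗ λ i → cong (weight i *_) (∑-δ (σ i y) f)) ⟨
          n * ∑[ i < m ] (weight i * ∑[ z < n ] (δ i z * f z))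
            ≡⟨ cong (n *_) (sum-cong-≗ λ i → *-distribˡ-sum (weight i) λ z → δ i z * f z) ⟩
          n * ∑[ i < m ] ∑[ z < n ] (weight i * (δ i z * f z))
            ≡⟨ cong (n *_) (∑-comm λ i z → weight i * (δ i z * f z)) ⟩
          n * ∑[ z < n ] ∑[ i < m ] (weight i * (δ i z * f z))
            ≡⟨ cong (n *_) (sum-cong-≗ collect) ⟩
          n * ∑[ z < n ] (hits y z * f z)
            ≡⟨ *-distribˡ-sum n (λ z → hits y z * f z) ⟩
          ∑[ z < n ] (n * (hits y z * f z))
            ≡⟨ sum-cong-≗ (λ z → trans (sym (*-assoc n (hits y z) (f z)))
                                       (cong (_* f z) (n*hits≡order y z))) ⟩
          ∑[ z < n ] (order * f z)
            ≡⟨ *-distribˡ-sum order f ⟨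
          order * ∑[ z < n ] f z ∎
          where
          open ≡-Reasoning
          δ : Fin m → Fin n → ℕ
          δ i z = [ does (σ i y ≟ z) ]
          collect : ∀ z → ∑[ i < m ] (weight i * (δ i z * f z)) ≡ hits y z * f z
          collect z = trans (sum-cong-≗ λ i → sym (*-assoc (weight i) (δ i z) (f z)))
                            (sym (*-distribʳ-sum (f z) λ i → weight i * δ i z))

        double-count : ∀ C → n * ∑[ i < m ] (weight i * kept C (σ i)) ≡ order * (∣ C ∣ * ∣ C ∣)
        double-count C = begin
          n * ∑[ i < m ] (weight i * ∑[ y < n ] ([ χ y ] * [ χ (σ i y) ]))
            ≡⟨ cong (n *_) (sum-cong-≗ λ i → *-distribˡ-sum (weight i) λ y → [ χ y ] * [ χ (σ i y) ]) ⟩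
          n * ∑[ i < m ] ∑[ y < n ] (weight i * ([ χ y ] * [ χ (σ i y) ]))
            ≡⟨ cong (n *_) (∑-comm λ i y → weight i * ([ χ y ] * [ χ (σ i y) ])) ⟩
          n * ∑[ y < n ] ∑[ i < m ] (weight i * ([ χ y ] * [ χ (σ i y) ]))
            ≡⟨ cong (n *_) (sum-cong-≗ factor) ⟩
          n * ∑[ y < n ] ([ χ y ] * inC y)
            ≡⟨ *-distribˡ-sum n (λ y → [ χ y ] * inC y) ⟩
          ∑[ y < n ] (n * ([ χ y ] * inC y))
            ≡⟨ sum-cong-≗ (λ y → trans (x∙yz≈y∙xz n [ χ y ] (inC y)) (cong ([ χ y ] *_) (average y))) ⟩
          ∑[ y < n ] ([ χ y ] * (order * ∣ C ∣))
            ≡⟨ *-distribʳ-sum (order * ∣ C ∣) (λ y → [ χ y ]) ⟨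
          ∑[ y < n ] [ χ y ] * (order * ∣ C ∣)
            ≡⟨ cong (_* (order * ∣ C ∣)) (∣p∣≡∑ C) ⟨
          ∣ C ∣ * (order * ∣ C ∣)
            ≡⟨ x∙yz≈y∙xz (∣ C ∣) order (∣ C ∣) ⟩
          order * (∣ C ∣ * ∣ C ∣) ∎
          where
          open ≡-Reasoning
          χ : Fin n → Bool
          χ = lookup C
          inC : Fin n → ℕ
          inC y = ∑[ i < m ] (weight i * [ χ (σ i y) ])
          factor : ∀ y → ∑[ i < m ] (weight i * ([ χ y ] * [ χ (σ i y) ])) ≡ [ χ y ] * inC y
          factor y = trans (sum-cong-≗ λ i → x∙yz≈y∙xz (weight i) [ χ y ] [ χ (σ i y) ])
                           (sym (*-distribˡ-sum [ χ y ] λ i → weight i * [ χ (σ i y) ]))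
          average : ∀ y → n * inC y ≡ order * ∣ C ∣
          average y = trans (orbit-average y λ z → [ χ z ]) (cong (order *_) (sym (∣p∣≡∑ C)))

        small-kept : ∀ C → ∃ λ g → n * kept C (act g) ≤ ∣ C ∣ * ∣ C ∣
        small-kept C with ∃-below-mean canonical? (λ i → n * kept C (σ i)) some-canonical mean≤
          where
          some-canonical : ∃ Canonical
          some-canonical = let j , cj , _ = canonical-exists (index ε) in j , cj
          mean≤ : ∑[ i < m ] (weight i * (n * kept C (σ i))) ≤ order * (∣ C ∣ * ∣ C ∣)
          mean≤ = ≤-reflexive (begin
            ∑[ i < m ] (weight i * (n * kept C (σ i)))
              ≡⟨ sum-cong-≗ (λ i → x∙yz≈y∙xz (weight i) n (kept C (σ i))) ⟩
            ∑[ i < m ] (n * (weight i * kept C (σ i)))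
              ≡⟨ *-distribˡ-sum n (λ i → weight i * kept C (σ i)) ⟨
            n * ∑[ i < m ] (weight i * kept C (σ i))
              ≡⟨ double-count C ⟩
            order * (∣ C ∣ * ∣ C ∣) ∎)
            where open ≡-Reasoning
        ... | i , _ , bound = enum i , bound

        large-symmetric-difference : ∀ C → ∃ λ g → 2 * ∣ C ∣ * ∣ ∁ C ∣ ≤ ∣ C △ image (act g) C ∣ * n
        large-symmetric-difference C with small-kept C
        ... | g , n*kept≤∣C∣² = g ⁻¹ ,
          t+2k≡2c⇒2cd≤tn (∣ C ∣) (∣ ∁ C ∣) (∣ C △ image (act (g ⁻¹)) C ∣) (kept C (act g))
            (∣p∣+∣∁p∣≡n C)
            (∣C△fC∣+2kept≡2∣C∣ (act (g ⁻¹)) (act g) (act-inverseʳ g) (act-inverseˡ g) C)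
            n*kept≤∣C∣²

open Counting using (∣p∣+∣∁p∣≡n; nonempty⇒∣p∣>0; large-symmetric-difference)

open import Data.Nat as ℕ using (ℕ; NonZero; >-nonZero)
import Data.Nat.Properties as ℕ
open import Data.Nat.Coprimality using (1-coprimeTo)
import Data.Nat.Coprimality as Coprime
open import Data.Integer as ℤ using (+_; +≤+)
import Data.Integer.Properties as ℤ
open import Data.Rational as ℚ
  using (ℚ; _≤_; _<_; _*_; 0ℚ; 1ℚ; ½; mkℚ; Positive; NonNegative; *≤*)
open import Data.Rational.Properties
  using (normalize-coprime; drop-*≤*; *-assoc; *-comm; *-identityˡ;
         *-cancelˡ-≤-pos; *-cancelʳ-≤-pos; *-monoʳ-≤-nonNeg; *-monoˡ-≤-nonNeg; module ≤-Reasoning)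
open import Algebra.Properties.CommutativeSemigroup ℕ.*-commutativeSemigroup using (x∙yz≈yx∙z)
open import Data.Product using (_,_)
open import Relation.Binary.PropositionalEquality using (_≡_; refl; sym; cong; subst; subst₂)

ℕ→ℚ≡mkℚ : ∀ k → ℕ→ℚ k ≡ mkℚ (+ k) 0 (Coprime.sym (1-coprimeTo k))
ℕ→ℚ≡mkℚ k = normalize-coprime (Coprime.sym (1-coprimeTo k))

ℕ→ℚ-homo-* : ∀ a b → ℕ→ℚ (a ℕ.* b) ≡ ℕ→ℚ a * ℕ→ℚ b
ℕ→ℚ-homo-* a b rewrite ℕ→ℚ≡mkℚ a | ℕ→ℚ≡mkℚ b = cong (ℚ._/ 1) (ℤ.pos-* a b)

ℕ→ℚ-mono-≤ : ∀ {a b} → a ℕ.≤ b → ℕ→ℚ a ≤ ℕ→ℚ b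
ℕ→ℚ-mono-≤ {a} {b} a≤b rewrite ℕ→ℚ≡mkℚ a | ℕ→ℚ≡mkℚ b =
  *≤* (subst₂ ℤ._≤_ (sym (ℤ.*-identityʳ (+ a))) (sym (ℤ.*-identityʳ (+ b))) (+≤+ a≤b))

ℕ→ℚ-cancel-≤ : ∀ {a b} → ℕ→ℚ a ≤ ℕ→ℚ b → a ℕ.≤ b
ℕ→ℚ-cancel-≤ {a} {b} a≤b rewrite ℕ→ℚ≡mkℚ a | ℕ→ℚ≡mkℚ b =
  ℤ.drop‿+≤+ (subst₂ ℤ._≤_ (ℤ.*-identityʳ (+ a)) (ℤ.*-identityʳ (+ b)) (drop-*≤* a≤b))

ℕ→ℚ-nonNegative : ∀ k → NonNegative (ℕ→ℚ k)
ℕ→ℚ-nonNegative k = subst NonNegative (sym (ℕ→ℚ≡mkℚ k)) _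

ℕ→ℚ-positive : ∀ k .{{_ : NonZero k}} → Positive (ℕ→ℚ k)
ℕ→ℚ-positive (ℕ.suc k) = subst Positive (sym (ℕ→ℚ≡mkℚ (ℕ.suc k))) _

2cd≤tn⇒2d≤εn : ∀ ε c d t n .{{_ : NonZero c}} →
               2 ℕ.* c ℕ.* d ℕ.≤ t ℕ.* n → ℕ→ℚ t ≤ ε * ℕ→ℚ c → ℕ→ℚ (2 ℕ.* d) ≤ ε * ℕ→ℚ n
2cd≤tn⇒2d≤εn ε c d t n 2cd≤tn t≤εc = *-cancelˡ-≤-pos (ℕ→ℚ c) {{ℕ→ℚ-positive c}} (begin
  ℕ→ℚ c * ℕ→ℚ (2 ℕ.* d)   ≡⟨ ℕ→ℚ-homo-* c (2 ℕ.* d) ⟨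
  ℕ→ℚ (c ℕ.* (2 ℕ.* d))   ≡⟨ cong ℕ→ℚ (x∙yz≈yx∙z c 2 d) ⟩
  ℕ→ℚ (2 ℕ.* c ℕ.* d)     ≤⟨ ℕ→ℚ-mono-≤ 2cd≤tn ⟩
  ℕ→ℚ (t ℕ.* n)           ≡⟨ ℕ→ℚ-homo-* t n ⟩
  ℕ→ℚ t * ℕ→ℚ n           ≤⟨ *-monoʳ-≤-nonNeg (ℕ→ℚ n) {{ℕ→ℚ-nonNegative n}} t≤εc ⟩
  ε * ℕ→ℚ c * ℕ→ℚ n       ≡⟨ cong (_* ℕ→ℚ n) (*-comm ε (ℕ→ℚ c)) ⟩
  ℕ→ℚ c * ε * ℕ→ℚ n       ≡⟨ *-assoc (ℕ→ℚ c) ε (ℕ→ℚ n) ⟩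
  ℕ→ℚ c * (ε * ℕ→ℚ n)     ∎)
  where open ≤-Reasoning

2d≤εn⇒d≤½εn : ∀ ε d n → ℕ→ℚ (2 ℕ.* d) ≤ ε * ℕ→ℚ n → ℕ→ℚ d ≤ (½ * ε) * ℕ→ℚ n
2d≤εn⇒d≤½εn ε d n 2d≤εn = begin
  ℕ→ℚ d                   ≡⟨ *-identityˡ (ℕ→ℚ d) ⟨
  ½ * ℕ→ℚ 2 * ℕ→ℚ d       ≡⟨ *-assoc ½ (ℕ→ℚ 2) (ℕ→ℚ d) ⟩
  ½ * (ℕ→ℚ 2 * ℕ→ℚ d)     ≡⟨ cong (½ *_) (ℕ→ℚ-homo-* 2 d) ⟨
  ½ * ℕ→ℚ (2 ℕ.* d)       ≤⟨ *-monoˡ-≤-nonNeg ½ 2d≤εn ⟩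
  ½ * (ε * ℕ→ℚ n)         ≡⟨ *-assoc ½ ε (ℕ→ℚ n) ⟨
  ½ * ε * ℕ→ℚ n           ∎
  where open ≤-Reasoning

at-most-half⇒1≤ε : ∀ ε c d {n} .{{_ : NonZero c}} → c ℕ.+ d ≡ n →
                   ℕ→ℚ c ≤ ½ * ℕ→ℚ n → ℕ→ℚ (2 ℕ.* d) ≤ ε * ℕ→ℚ n → 1ℚ ≤ ε
at-most-half⇒1≤ε ε c d refl c≤n/2 2d≤εn = *-cancelʳ-≤-pos (ℕ→ℚ n) {{ℕ→ℚ-positive n {{n≢0}}}} (begin
  1ℚ * ℕ→ℚ n       ≡⟨ *-identityˡ (ℕ→ℚ n) ⟩
  ℕ→ℚ n            ≤⟨ ℕ→ℚ-mono-≤ n≤2d ⟩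
  ℕ→ℚ (2 ℕ.* d)    ≤⟨ 2d≤εn ⟩
  ε * ℕ→ℚ n        ∎)
  where
  open ≤-Reasoning
  n = c ℕ.+ d
  n≢0 : NonZero n
  n≢0 = >-nonZero (ℕ.<-≤-trans (ℕ.>-nonZero⁻¹ c) (ℕ.m≤m+n c d))
  2c≤n : 2 ℕ.* c ℕ.≤ n
  2c≤n = ℕ→ℚ-cancel-≤ (begin
    ℕ→ℚ (2 ℕ.* c)       ≡⟨ ℕ→ℚ-homo-* 2 c ⟩
    ℕ→ℚ 2 * ℕ→ℚ c       ≤⟨ *-monoˡ-≤-nonNeg (ℕ→ℚ 2) c≤n/2 ⟩
    ℕ→ℚ 2 * (½ * ℕ→ℚ n) ≡⟨ *-assoc (ℕ→ℚ 2) ½ (ℕ→ℚ n) ⟨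
    1ℚ * ℕ→ℚ n          ≡⟨ *-identityˡ (ℕ→ℚ n) ⟩
    ℕ→ℚ n               ∎)
  c≤d : c ℕ.≤ d
  c≤d = ℕ.+-cancelˡ-≤ c c d (subst (ℕ._≤ n) (cong (c ℕ.+_) (ℕ.+-identityʳ c)) 2c≤n)
  n≤2d : n ℕ.≤ 2 ℕ.* d
  n≤2d = subst (n ℕ.≤_) (cong (d ℕ.+_) (sym (ℕ.+-identityʳ d))) (ℕ.+-monoˡ-≤ d c≤d)

lemma5p1 : {c ℓ : Level} (H : Group c ℓ) → FiniteGroup H
    → (n : ℕ) (act : Group.Carrier H → Fin n → Fin n)
    → IsAction H act → Transitive H act
    → (ε : ℚ) → 0ℚ < ε
    → (C : Subset n) → Nonempty C
    → (∀ h → ℕ→ℚ ∣ C △ image (act h) C ∣ ≤ ε * ℕ→ℚ ∣ C ∣)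
    → (ℕ→ℚ ∣ ∁ C ∣ ≤ (½ * ε) * ℕ→ℚ n)
    × (ℕ→ℚ ∣ C ∣ ≤ ½ * ℕ→ℚ n → 1ℚ ≤ ε)
lemma5p1 H (_ , enum , enum-onto) n act isAction transitive ε _ C nonempty moved-by =
  2d≤εn⇒d≤½εn ε d n 2d≤εn , λ c≤n/2 → at-most-half⇒1≤ε ε c d (∣p∣+∣∁p∣≡n C) c≤n/2 2d≤εn
  where
  c d : ℕ
  c = ∣ C ∣
  d = ∣ ∁ C ∣
  instance
    c≢0 : NonZero c
    c≢0 = >-nonZero (nonempty⇒∣p∣>0 nonempty)
  2d≤εn : ℕ→ℚ (2 ℕ.* d) ≤ ε * ℕ→ℚ n
  2d≤εn = let g , 2cd≤tn = large-symmetric-difference H isAction enum enum-onto transitive C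
          in 2cd≤tn⇒2d≤εn ε c d (∣ C △ image (act g) C ∣) n 2cd≤tn (moved-by g)
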